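{- Consider any $1\times 1$ Rush Hour instance with no fixed blocks in which exactly one cell of the board is empty. Call a cell accessible if there is a sequence of legal moves from the initial configuration after which that cell is the empty cell. Then the set of accessible cells forms a rectangle (an axis-aligned rectangular block of grid cells).
   Context: $1\times 1$ Rush Hour: a square grid of cells, each cell either empty or containing a car occupying exactly one cell; each car is labeled horizontal or vertical. A legal move shifts one car by one cell in the direction of its orientation (left or right for a horizontal car, up or down for a vertical car) into an empty cell inside the grid. -}

module Defs where

open import Data.Nat using (ℕ; suc)
open import Data.Fin using (Fin; toℕ; _≟_)
open import Data.Sum using (_⊎_)
open import Data.Product using (_×_; _,_; Σ; ∃)
open import Data.Bool using (Bool; true; false; _∧_)
open import Relation.Nullary using (¬_; yes; no)
open import Relation.Nullary.Decidable using (⌊_⌋)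
open import Relation.Binary.PropositionalEquality using (_≡_)
open import Relation.Binary.Construct.Closure.ReflexiveTransitive using (Star)

-- Contents of a cell: empty, or a 1×1 car that is horizontal or vertical.
data Cell : Set where
  empty horiz vert : Cell

-- A cell of the n×n board: (row , column).
Pos : ℕ → Set
Pos n = Fin n × Fin n

Config : ℕ → Set
Config n = Pos n → Cell

swap : ∀ {n} → Pos n → Pos n → Config n → Config n
swap (pr , pc) (qr , qc) b (r , c) with ⌊ r ≟ pr ⌋ ∧ ⌊ c ≟ pc ⌋ | ⌊ r ≟ qr ⌋ ∧ ⌊ c ≟ qc ⌋
... | true  | _     = b (qr , qc)
... | false | true  = b (pr , pc)
... | false | false = b (r , c)

Adj : ∀ {n} → Fin n → Fin n → Set
Adj i j = suc (toℕ i) ≡ toℕ j ⊎ suc (toℕ j) ≡ toℕ i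

data Move {n : ℕ} (b : Config n) : Config n → Set where
  moveH : (r c c' : Fin n) → b (r , c) ≡ horiz → b (r , c') ≡ empty → Adj c c' →
          Move b (swap (r , c) (r , c') b)
  moveV : (r r' c : Fin n) → b (r , c) ≡ vert → b (r' , c) ≡ empty → Adj r r' →
          Move b (swap (r , c) (r' , c) b)

Reach : ∀ {n} → Config n → Config n → Set
Reach = Star Move

ExactlyOneEmpty : ∀ {n} → Config n → Set
ExactlyOneEmpty {n} b =
  Σ (Pos n) λ e → b e ≡ empty × (∀ p → b p ≡ empty → p ≡ e)

Accessible : ∀ {n} → Config n → Pos n → Set
Accessible {n} b p = Σ (Config n) λ b' → Reach b b' × b' p ≡ empty

-- Grow a rectangle R of accessible cells outwards from the empty cell. A cell whose
-- row-neighbour and column-neighbour are both accessible is itself accessible: a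
-- horizontal car slides into the row-neighbour once that is emptied, a vertical car into
-- the column-neighbour. Hence, if a car just outside R can slide into R, that car's cell
-- and then the whole line of cells beside R containing it are accessible, and R can be
-- enlarged by that line. When no car can enter R any more, R is sealed: along any
-- sequence of moves the empty cell stays in R and nothing outside R changes, so no cell
-- outside R is accessible.
module Submission where

open import Defs
open import Data.Nat using (ℕ; suc; s≤s; s≤s⁻¹; _+_; _∸_; _≤_; _<_; _≤′_; ≤′-refl; ≤′-step; _≤?_)
  renaming (_≟_ to _≟ℕ_)
open import Data.Nat.Properties
open import Data.Nat.Induction using (<-wellFounded)
open import Data.Fin using (Fin; toℕ; fromℕ<) renaming (_≟_ to _≟ᶠ_)
open import Data.Fin.Properties using (toℕ<n; toℕ-fromℕ<; fromℕ<-toℕ; toℕ-injective; any?)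
open import Data.Product using (_×_; _,_; Σ; proj₁; proj₂)
open import Data.Product.Properties using (≡-dec)
open import Data.Sum using (_⊎_; inj₁; inj₂) renaming (swap to ⊎-swap)
open import Data.Empty using (⊥-elim)
open import Function using (id; _∘_)
open import Function.Bundles using (_⇔_; mk⇔; Equivalence)
open import Function.Properties.Equivalence using ()
  renaming (refl to ⇔-refl; sym to ⇔-sym; trans to ⇔-trans)
open import Induction.WellFounded using (Acc; acc)
open import Relation.Nullary using (¬_; Dec; yes; no)
open import Relation.Nullary.Decidable using (map′; _×-dec_; _⊎-dec_; ¬?; decidable-stable)
open import Relation.Binary.PropositionalEquality using (_≡_; _≢_; refl; sym; trans; cong; cong₂; subst)
open import Relation.Binary.Construct.Closure.ReflexiveTransitive using (ε; _◅_; _◅◅_)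

private
  variable
    n : ℕ
    s s′ : Config n

module _ (Q : ℕ → Set) {lo hi : ℕ} (step : ∀ {i} → lo ≤ i → suc i ≤ hi → Q i ⇔ Q (suc i)) where

  ⇔-along-≤′ : ∀ {i j} → i ≤′ j → lo ≤ i → j ≤ hi → Q i ⇔ Q j
  ⇔-along-≤′ ≤′-refl _ _ = ⇔-refl
  ⇔-along-≤′ (≤′-step i≤′j) lo≤i sj≤hi =
    ⇔-trans (⇔-along-≤′ i≤′j lo≤i (<⇒≤ sj≤hi)) (step (≤-trans lo≤i (≤′⇒≤ i≤′j)) sj≤hi)

  ⇔-within-interval : ∀ {i j} → lo ≤ i → i ≤ hi → lo ≤ j → j ≤ hi → Q i ⇔ Q j
  ⇔-within-interval {i} {j} lo≤i i≤hi lo≤j j≤hi with ≤-total i j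
  ... | inj₁ i≤j = ⇔-along-≤′ (≤⇒≤′ i≤j) lo≤i j≤hi
  ... | inj₂ j≤i = ⇔-sym (⇔-along-≤′ (≤⇒≤′ j≤i) lo≤j i≤hi)

record Interval (n : ℕ) : Set where
  constructor [_,_]
  field
    lo hi : Fin n

open Interval

_∈ᵢ_ : ℕ → Interval n → Set
x ∈ᵢ I = toℕ (lo I) ≤ x × x ≤ toℕ (hi I)

_∈ᵢ?_ : ∀ x (I : Interval n) → Dec (x ∈ᵢ I)
x ∈ᵢ? I = (toℕ (lo I) ≤? x) ×-dec (x ≤? toℕ (hi I))

Adj-sym : {i j : Fin n} → Adj i j → Adj j i
Adj-sym = ⊎-swap

Adj-irrefl : {i : Fin n} → ¬ Adj i i
Adj-irrefl (inj₁ e) = 1+n≢n e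
Adj-irrefl (inj₂ e) = 1+n≢n e

Adj? : (i j : Fin n) → Dec (Adj i j)
Adj? i j = (suc (toℕ i) ≟ℕ toℕ j) ⊎-dec (suc (toℕ j) ≟ℕ toℕ i)

spread-along-interval : (Q : Fin n → Set) (I : Interval n) →
  (∀ {x y} → toℕ x ∈ᵢ I → toℕ y ∈ᵢ I → Adj x y → Q x → Q y) →
  ∀ {x y} → toℕ x ∈ᵢ I → toℕ y ∈ᵢ I → Q x → Q y
spread-along-interval {n} Q I step {x} {y} (lo≤x , x≤hi) (lo≤y , y≤hi) Qx =
  subst Q (fromℕ<-toℕ y (toℕ<n y))
    (Equivalence.to (⇔-within-interval Q-at step-at lo≤x x≤hi lo≤y y≤hi)
      (λ x<n → subst Q (sym (fromℕ<-toℕ x x<n)) Qx) (toℕ<n y))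
  where
  -- The bound argument of fromℕ< is irrelevant, so Q-at i is independent of the proof of i < n.
  Q-at : ℕ → Set
  Q-at i = (i<n : i < n) → Q (fromℕ< i<n)

  step-at : ∀ {i} → toℕ (lo I) ≤ i → suc i ≤ toℕ (hi I) → Q-at i ⇔ Q-at (suc i)
  step-at {i} lo≤i si≤hi =
    mk⇔ (λ Qi _ → step i∈ si∈ adj (Qi i<n)) (λ Qsi _ → step si∈ i∈ (Adj-sym adj) (Qsi si<n))
    where
    si<n : suc i < n
    si<n = ≤-<-trans si≤hi (toℕ<n (hi I))
    i<n : i < n
    i<n = <-trans (n<1+n i) si<n
    i∈ : toℕ (fromℕ< i<n) ∈ᵢ I
    i∈ = subst (_∈ᵢ I) (sym (toℕ-fromℕ< i<n)) (lo≤i , <⇒≤ si≤hi)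
    si∈ : toℕ (fromℕ< si<n) ∈ᵢ I
    si∈ = subst (_∈ᵢ I) (sym (toℕ-fromℕ< si<n)) (≤-trans lo≤i (n≤1+n i) , si≤hi)
    adj : Adj (fromℕ< i<n) (fromℕ< si<n)
    adj = inj₁ (trans (cong suc (toℕ-fromℕ< i<n)) (sym (toℕ-fromℕ< si<n)))

data Extends (I : Interval n) (x : Fin n) : Interval n → Set where
  below : suc (toℕ x) ≡ toℕ (lo I) → Extends I x [ x , hi I ]
  above : toℕ x ≡ suc (toℕ (hi I)) → Extends I x [ lo I , x ]

outside-adjacent-extends : {I : Interval n} {x y : Fin n} →
  ¬ toℕ x ∈ᵢ I → toℕ y ∈ᵢ I → Adj x y → Σ (Interval n) (Extends I x)
outside-adjacent-extends {x = x} x∉I (lo≤y , y≤hi) (inj₁ sx≡y) = _ , below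
  (≤-antisym (≰⇒> (λ lo≤x → x∉I (lo≤x , x≤hi))) (subst (_ ≤_) (sym sx≡y) lo≤y))
  where
  x≤hi : toℕ x ≤ _
  x≤hi = ≤-trans (n≤1+n (toℕ x)) (subst (_≤ _) (sym sx≡y) y≤hi)
outside-adjacent-extends {x = x} x∉I (lo≤y , y≤hi) (inj₂ sy≡x) = _ , above
  (≤-antisym (subst (_≤ _) sy≡x (s≤s y≤hi)) (≰⇒> (λ x≤hi → x∉I (lo≤x , x≤hi))))
  where
  lo≤x : _ ≤ toℕ x
  lo≤x = ≤-trans lo≤y (subst (_ ≤_) sy≡x (n≤1+n _))

extends-⊇ : {I J : Interval n} {x : Fin n} {v : ℕ} → Extends I x J → v ∈ᵢ I → v ∈ᵢ J
extends-⊇ (below sx≡lo) (lo≤v , v≤hi) = ≤-trans (n≤1+n _) (subst (_≤ _) (sym sx≡lo) lo≤v) , v≤hi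
extends-⊇ (above x≡shi) (lo≤v , v≤hi) = lo≤v , ≤-trans v≤hi (subst (_ ≤_) (sym x≡shi) (n≤1+n _))

extends-split : {I J : Interval n} {x y : Fin n} → Extends I x J → toℕ y ∈ᵢ J → y ≡ x ⊎ toℕ y ∈ᵢ I
extends-split (below sx≡lo) (x≤y , y≤hi) with m≤n⇒m<n∨m≡n x≤y
... | inj₁ x<y = inj₂ (subst (_≤ _) sx≡lo x<y , y≤hi)
... | inj₂ x≡y = inj₁ (toℕ-injective (sym x≡y))
extends-split (above x≡shi) (lo≤y , y≤x) with m≤n⇒m<n∨m≡n y≤x
... | inj₁ y<x = inj₂ (lo≤y , s≤s⁻¹ (subst (_ ≤_) x≡shi y<x))
... | inj₂ y≡x = inj₁ (toℕ-injective y≡x)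

slack : Interval n → ℕ
slack {n} I = toℕ (lo I) + (n ∸ toℕ (hi I))

extends-slack : {I J : Interval n} {x : Fin n} → Extends I x J → slack J < slack I
extends-slack {n} {I} (below sx≡lo) = +-monoˡ-< (n ∸ toℕ (hi I)) (≤-reflexive sx≡lo)
extends-slack {n} {I} {x = x} (above x≡shi) =
  +-monoʳ-< (toℕ (lo I)) (∸-monoʳ-< (≤-reflexive (sym x≡shi)) (<⇒≤ (toℕ<n x)))

_≟ₚ_ : (p q : Pos n) → Dec (p ≡ q)
_≟ₚ_ = ≡-dec _≟ᶠ_ _≟ᶠ_

swap-source : (p q : Pos n) (s : Config n) → swap p q s p ≡ s q
swap-source (pr , pc) _ _ with pr ≟ᶠ pr | pc ≟ᶠ pc
... | yes _ | yes _ = refl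
... | no pr≢pr | _ = ⊥-elim (pr≢pr refl)
... | yes _ | no pc≢pc = ⊥-elim (pc≢pc refl)

swap-target : (p q : Pos n) (s : Config n) → q ≢ p → swap p q s q ≡ s p
swap-target (pr , pc) (qr , qc) _ q≢p with qr ≟ᶠ pr | qc ≟ᶠ pc | qr ≟ᶠ qr | qc ≟ᶠ qc
... | yes refl | yes refl | _ | _ = ⊥-elim (q≢p refl)
... | _ | _ | no qr≢qr | _ = ⊥-elim (qr≢qr refl)
... | _ | _ | yes _ | no qc≢qc = ⊥-elim (qc≢qc refl)
... | no _ | _ | yes _ | yes _ = refl
... | yes _ | no _ | yes _ | yes _ = refl

swap-elsewhere : (p q y : Pos n) (s : Config n) → y ≢ p → y ≢ q → swap p q s y ≡ s y
swap-elsewhere (pr , pc) (qr , qc) (r , c) _ y≢p y≢q with r ≟ᶠ pr | c ≟ᶠ pc | r ≟ᶠ qr | c ≟ᶠ qc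
... | yes refl | yes refl | _ | _ = ⊥-elim (y≢p refl)
... | _ | _ | yes refl | yes refl = ⊥-elim (y≢q refl)
... | no _ | _ | no _ | _ = refl
... | no _ | _ | yes _ | no _ = refl
... | yes _ | no _ | no _ | _ = refl
... | yes _ | no _ | yes _ | no _ = refl

data CanSlide (s : Config n) : Pos n → Pos n → Set where
  horizontal : ∀ {r c c′} → s (r , c) ≡ horiz → Adj c c′ → CanSlide s (r , c) (r , c′)
  vertical   : ∀ {r r′ c} → s (r , c) ≡ vert → Adj r r′ → CanSlide s (r , c) (r′ , c)

data Slid (s : Config n) : Config n → Set where
  slid : ∀ {p q} → CanSlide s p q → s q ≡ empty → Slid s (swap p q s)

slide : ∀ {p q} → CanSlide s p q → s q ≡ empty → Move s (swap p q s)
slide (horizontal car adj) q-empty = moveH _ _ _ car q-empty adj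
slide (vertical car adj) q-empty = moveV _ _ _ car q-empty adj

move-slides : Move s s′ → Slid s s′
move-slides (moveH _ _ _ car q-empty adj) = slid (horizontal car adj) q-empty
move-slides (moveV _ _ _ car q-empty adj) = slid (vertical car adj) q-empty

CanSlide-nonempty : ∀ {p q} → CanSlide s p q → s p ≢ empty
CanSlide-nonempty (horizontal car _) p-empty with trans (sym car) p-empty
... | ()
CanSlide-nonempty (vertical car _) p-empty with trans (sym car) p-empty
... | ()

CanSlide-distinct : ∀ {p q} → CanSlide s p q → q ≢ p
CanSlide-distinct (horizontal _ adj) refl = Adj-irrefl adj
CanSlide-distinct (vertical _ adj) refl = Adj-irrefl adj

CanSlide-transport : ∀ {p q} → CanSlide s p q → s p ≡ s′ p → CanSlide s′ p q
CanSlide-transport (horizontal car adj) same = horizontal (trans (sym same) car) adj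
CanSlide-transport (vertical car adj) same = vertical (trans (sym same) car) adj

canSlide? : (s : Config n) (p q : Pos n) → Dec (CanSlide s p q)
canSlide? s (r , c) (r′ , c′) with s (r , c) in car
... | empty = no λ can → CanSlide-nonempty can car
... | horiz with (r ≟ᶠ r′) ×-dec Adj? c c′
...   | yes (refl , adj) = yes (horizontal car adj)
...   | no ¬row = no λ { (horizontal _ adj) → ¬row (refl , adj)
                       ; (vertical car′ _) → horiz≢vert (trans (sym car) car′) }
  where
  horiz≢vert : horiz ≢ vert
  horiz≢vert ()
canSlide? s (r , c) (r′ , c′) | vert with (c ≟ᶠ c′) ×-dec Adj? r r′
...   | yes (refl , adj) = yes (vertical car adj)
...   | no ¬column = no λ { (vertical _ adj) → ¬column (refl , adj)
                          ; (horizontal car′ _) → vert≢horiz (trans (sym car) car′) }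
  where
  vert≢horiz : vert ≢ horiz
  vert≢horiz ()

accessible⊎unchanged-by-move : Move s s′ → (y : Pos n) → Accessible s y ⊎ s′ y ≡ s y
accessible⊎unchanged-by-move {s = s} m y with move-slides m
... | slid {p} {q} _ q-empty with y ≟ₚ p | y ≟ₚ q
...   | yes refl | _ = inj₁ (_ , m ◅ ε , trans (swap-source p q s) q-empty)
...   | no _ | yes refl = inj₁ (s , ε , q-empty)
...   | no y≢p | no y≢q = inj₂ (swap-elsewhere p q y s y≢p y≢q)

accessible⊎unchanged : Reach s s′ → (y : Pos n) → Accessible s y ⊎ s′ y ≡ s y
accessible⊎unchanged ε y = inj₂ refl
accessible⊎unchanged (m ◅ path) y with accessible⊎unchanged path y
... | inj₁ (t , path′ , y-empty) = inj₁ (t , m ◅ path′ , y-empty)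
... | inj₂ same with accessible⊎unchanged-by-move m y
...   | inj₁ y-accessible = inj₁ y-accessible
...   | inj₂ same′ = inj₂ (trans same same′)

-- Either p is emptied on the way to emptying q, or its car is still there and slides into q.
slide-accessible : ∀ {p q} → CanSlide s p q → Accessible s q → Accessible s p
slide-accessible {p = p} {q} can (t , path , q-empty) with accessible⊎unchanged path p
... | inj₁ p-accessible = p-accessible
... | inj₂ same = swap p q t , path ◅◅ slide (CanSlide-transport can (sym same)) q-empty ◅ ε ,
                  trans (swap-source p q t) q-empty

accessible-from-neighbours : {r r′ c c′ : Fin n} → Adj c c′ → Adj r r′ →
  Accessible s (r , c′) → Accessible s (r′ , c) → Accessible s (r , c)
accessible-from-neighbours {s = s} {r} {c = c} adj-c adj-r row-neighbour column-neighbour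
  with s (r , c) in content
... | empty = s , ε , content
... | horiz = slide-accessible (horizontal content adj-c) row-neighbour
... | vert  = slide-accessible (vertical content adj-r) column-neighbour

record Rect (n : ℕ) : Set where
  constructor _×ᵣ_
  field
    rows cols : Interval n

open Rect

_∈ᵣ_ : Pos n → Rect n → Set
p ∈ᵣ R = toℕ (proj₁ p) ∈ᵢ rows R × toℕ (proj₂ p) ∈ᵢ cols R

_∈ᵣ?_ : (p : Pos n) (R : Rect n) → Dec (p ∈ᵣ R)
p ∈ᵣ? R = (toℕ (proj₁ p) ∈ᵢ? rows R) ×-dec (toℕ (proj₂ p) ∈ᵢ? cols R)

_⊆ᵣ_ : Rect n → Rect n → Set
R ⊆ᵣ R′ = ∀ {p} → p ∈ᵣ R → p ∈ᵣ R′

point : Pos n → Rect n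
point (r , c) = [ r , r ] ×ᵣ [ c , c ]

∈-point : {p : Pos n} → p ∈ᵣ point p
∈-point = (≤-refl , ≤-refl) , (≤-refl , ≤-refl)

∈-point⇒≡ : {p e : Pos n} → p ∈ᵣ point e → p ≡ e
∈-point⇒≡ ((er≤r , r≤er) , (ec≤c , c≤ec)) =
  cong₂ _,_ (toℕ-injective (≤-antisym r≤er er≤r)) (toℕ-injective (≤-antisym c≤ec ec≤c))

slackᵣ : Rect n → ℕ
slackᵣ R = slack (rows R) + slack (cols R)

any-pos? : {P : Pos n → Set} → (∀ p → Dec (P p)) → Dec (Σ (Pos n) P)
any-pos? P? = map′ (λ (r , c , h) → (r , c) , h) (λ ((r , c) , h) → r , c , h)
                   (any? λ r → any? λ c → P? (r , c))

module Growth {n : ℕ} (b : Config n) where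

  AllAccessible : Rect n → Set
  AllAccessible R = ∀ {p} → p ∈ᵣ R → Accessible b p

  InwardSlide : Rect n → Set
  InwardSlide R = Σ (Pos n) λ p → Σ (Pos n) λ q → ¬ p ∈ᵣ R × q ∈ᵣ R × CanSlide b p q

  inwardSlide? : (R : Rect n) → Dec (InwardSlide R)
  inwardSlide? R = any-pos? λ p → any-pos? λ q → ¬? (p ∈ᵣ? R) ×-dec (q ∈ᵣ? R) ×-dec canSlide? b p q

  accessible-column : ∀ {R r r₁ c c′} → AllAccessible R → Adj c c′ → toℕ c′ ∈ᵢ cols R →
    toℕ r ∈ᵢ rows R → toℕ r₁ ∈ᵢ rows R → Accessible b (r , c) → Accessible b (r₁ , c)
  accessible-column {R} {c = c} all adj c′∈ =
    spread-along-interval (λ x → Accessible b (x , c)) (rows R)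
      (λ _ y∈ adj-xy → accessible-from-neighbours adj (Adj-sym adj-xy) (all (y∈ , c′∈)))

  accessible-row : ∀ {R r r′ c c₁} → AllAccessible R → Adj r r′ → toℕ r′ ∈ᵢ rows R →
    toℕ c ∈ᵢ cols R → toℕ c₁ ∈ᵢ cols R → Accessible b (r , c) → Accessible b (r , c₁)
  accessible-row {R} {r = r} all adj r′∈ =
    spread-along-interval (λ x → Accessible b (r , x)) (cols R)
      (λ _ y∈ adj-xy x-accessible →
        accessible-from-neighbours (Adj-sym adj-xy) adj x-accessible (all (r′∈ , y∈)))

  record Enlargement (R : Rect n) : Set where
    field
      larger : Rect n
      ⊇ : R ⊆ᵣ larger
      all-accessible : AllAccessible larger
      slack-decreases : slackᵣ larger < slackᵣ R

  widen : ∀ {R J r c c′} → AllAccessible R → Extends (cols R) c J → Adj c c′ →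
    toℕ c′ ∈ᵢ cols R → toℕ r ∈ᵢ rows R → Accessible b (r , c) → Enlargement R
  widen {R} {J} all ext adj c′∈ r∈ rc-accessible = record
    { larger = rows R ×ᵣ J
    ; ⊇ = λ (r₁∈ , c₁∈) → r₁∈ , extends-⊇ ext c₁∈
    ; all-accessible = all′
    ; slack-decreases = +-monoʳ-< (slack (rows R)) (extends-slack ext)
    }
    where
    all′ : AllAccessible (rows R ×ᵣ J)
    all′ {r₁ , c₁} (r₁∈ , c₁∈J) with extends-split ext c₁∈J
    ... | inj₁ refl = accessible-column all adj c′∈ r∈ r₁∈ rc-accessible
    ... | inj₂ c₁∈ = all (r₁∈ , c₁∈)

  heighten : ∀ {R J r r′ c} → AllAccessible R → Extends (rows R) r J → Adj r r′ →
    toℕ r′ ∈ᵢ rows R → toℕ c ∈ᵢ cols R → Accessible b (r , c) → Enlargement R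
  heighten {R} {J} all ext adj r′∈ c∈ rc-accessible = record
    { larger = J ×ᵣ cols R
    ; ⊇ = λ (r₁∈ , c₁∈) → extends-⊇ ext r₁∈ , c₁∈
    ; all-accessible = all′
    ; slack-decreases = +-monoˡ-< (slack (cols R)) (extends-slack ext)
    }
    where
    all′ : AllAccessible (J ×ᵣ cols R)
    all′ {r₁ , c₁} (r₁∈J , c₁∈) with extends-split ext r₁∈J
    ... | inj₁ refl = accessible-row all adj r′∈ c∈ c₁∈ rc-accessible
    ... | inj₂ r₁∈ = all (r₁∈ , c₁∈)

  enlarge : ∀ {R} → AllAccessible R → InwardSlide R → Enlargement R
  enlarge all (_ , _ , p∉R , (r∈ , c′∈) , can@(horizontal _ adj))
    with outside-adjacent-extends (λ c∈ → p∉R (r∈ , c∈)) c′∈ adj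
  ... | _ , ext = widen all ext adj c′∈ r∈ (slide-accessible can (all (r∈ , c′∈)))
  enlarge all (_ , _ , p∉R , (r′∈ , c∈) , can@(vertical _ adj))
    with outside-adjacent-extends (λ r∈ → p∉R (r∈ , c∈)) r′∈ adj
  ... | _ , ext = heighten all ext adj r′∈ c∈ (slide-accessible can (all (r′∈ , c∈)))

  grow : ∀ R → AllAccessible R → Acc _<_ (slackᵣ R) →
    Σ (Rect n) λ R′ → R ⊆ᵣ R′ × AllAccessible R′ × ¬ InwardSlide R′
  grow R all (acc smaller) with inwardSlide? R
  ... | no sealed = R , id , all , sealed
  ... | yes inward with enlarge all inward
  ...   | E with grow (Enlargement.larger E) (Enlargement.all-accessible E)
                      (smaller (Enlargement.slack-decreases E))
  ...     | R′ , ⊆ , all′ , sealed = R′ , ⊆ ∘ Enlargement.⊇ E , all′ , sealed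

  Confined : Rect n → Config n → Set
  Confined R s = (∀ {p} → s p ≡ empty → p ∈ᵣ R) × (∀ {p} → ¬ p ∈ᵣ R → s p ≡ b p)

  confined-move : ∀ {R} → ¬ InwardSlide R → Confined R s → Move s s′ → Confined R s′
  confined-move {s = s} {R = R} sealed (empty-inside , outside-fixed) m with move-slides m
  ... | slid {p} {q} can q-empty = empty-inside′ , outside-fixed′
    where
    q∈R : q ∈ᵣ R
    q∈R = empty-inside q-empty
    p∈R : p ∈ᵣ R
    p∈R = decidable-stable (p ∈ᵣ? R)
      λ p∉R → sealed (p , q , p∉R , q∈R , CanSlide-transport can (outside-fixed p∉R))
    empty-inside′ : ∀ {y} → swap p q s y ≡ empty → y ∈ᵣ R
    empty-inside′ {y} y-empty with y ≟ₚ p | y ≟ₚ q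
    ... | yes refl | _ = p∈R
    ... | no _ | yes refl =
      ⊥-elim (CanSlide-nonempty can (trans (sym (swap-target p q s (CanSlide-distinct can))) y-empty))
    ... | no y≢p | no y≢q = empty-inside (trans (sym (swap-elsewhere p q y s y≢p y≢q)) y-empty)
    outside-fixed′ : ∀ {y} → ¬ y ∈ᵣ R → swap p q s y ≡ b y
    outside-fixed′ y∉R =
      trans (swap-elsewhere p q _ s (λ { refl → y∉R p∈R }) (λ { refl → y∉R q∈R })) (outside-fixed y∉R)

  confined-reach : ∀ {R} → ¬ InwardSlide R → Confined R s → Reach s s′ → Confined R s′
  confined-reach sealed confined ε = confined
  confined-reach sealed confined (m ◅ path) = confined-reach sealed (confined-move sealed confined m) path

  point-accessible : ∀ {e} → b e ≡ empty → AllAccessible (point e)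
  point-accessible e-empty p∈ = subst (Accessible b) (sym (∈-point⇒≡ p∈)) (b , ε , e-empty)

  accessible-rectangle : ExactlyOneEmpty b →
    Σ (Rect n) λ R → Σ (Pos n) (_∈ᵣ R) × (∀ p → Accessible b p ⇔ p ∈ᵣ R)
  accessible-rectangle (e , e-empty , only-e) with grow (point e) (point-accessible e-empty) (<-wellFounded _)
  ... | R , ⊆ , all , sealed = R , (e , e∈R) , λ p → mk⇔ accessible⇒∈R all
    where
    e∈R : e ∈ᵣ R
    e∈R = ⊆ ∈-point
    confined : Confined R b
    confined = (λ p-empty → subst (_∈ᵣ R) (sym (only-e _ p-empty)) e∈R) , λ _ → refl
    accessible⇒∈R : ∀ {p} → Accessible b p → p ∈ᵣ R
    accessible⇒∈R (_ , path , p-empty) = proj₁ (confined-reach sealed confined path) p-empty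

theorem6 : (n : ℕ) (b : Config n) → ExactlyOneEmpty b →
    Σ (Fin n) λ r₁ → Σ (Fin n) λ r₂ → Σ (Fin n) λ c₁ → Σ (Fin n) λ c₂ →
      (toℕ r₁ ≤ toℕ r₂) × (toℕ c₁ ≤ toℕ c₂) ×
      ((r c : Fin n) →
        Accessible b (r , c) ⇔
          ((toℕ r₁ ≤ toℕ r × toℕ r ≤ toℕ r₂) × (toℕ c₁ ≤ toℕ c × toℕ c ≤ toℕ c₂)))
theorem6 n b one-empty with Growth.accessible-rectangle b one-empty
... | R , (_ , (lo≤r , r≤hi) , (lo≤c , c≤hi)) , accessible⇔∈R =
  lo (rows R) , hi (rows R) , lo (cols R) , hi (cols R) ,
  ≤-trans lo≤r r≤hi , ≤-trans lo≤c c≤hi , λ r c → accessible⇔∈R (r , c)
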